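{- Let $\mathcal{G}$ be the class of all simple graphs in which every connected component is a clique or a tree. Then a simple graph $G$ belongs to $\mathcal{G}$ if and only if $G$ contains no paw, no diamond, and no cycle $C_i$ with $i \ge 4$ as an induced subgraph.
   Context: A paw is the graph on vertices $u_1,u_2,u_3,u_4$ in which $u_1,u_2,u_3$ form a triangle and $u_4$ is adjacent only to $u_1$. A diamond is the graph on vertices $u_1,u_2,u_3,u_4$ in which $u_1,u_2,u_3$ form a triangle and $u_4$ is adjacent exactly to $u_1$ and $u_2$. $C_i$ denotes the cycle on $i$ vertices. -}

module Defs where

open import Data.Nat using (ℕ; zero; suc; _≤_; _≡ᵇ_)
open import Data.Fin using (Fin; toℕ)
open import Data.Bool using (Bool; true; false; _∨_; _∧_)
open import Data.Product using (Σ; _×_; ∃-syntax)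
open import Data.Sum using (_⊎_)
open import Relation.Binary.PropositionalEquality using (_≡_; _≢_)
open import Relation.Nullary using (¬_)
open import Function.Definitions using (Injective)

record Graph (n : ℕ) : Set where
  field
    adj    : Fin n → Fin n → Bool
    sym    : ∀ u v → adj u v ≡ adj v u
    irrefl : ∀ v → adj v v ≡ false
open Graph public

-- Reachability (walks) in G; connected components are its classes.
data Reach {n : ℕ} (G : Graph n) : Fin n → Fin n → Set where
  here : ∀ {u} → Reach G u u
  step : ∀ {u w v} → adj G u w ≡ true → Reach G w v → Reach G u v

-- Adjacency of the cycle C_m on vertices 0,…,m-1 (i ~ i+1 mod m); a genuine
-- cycle for m ≥ 3.
cycAdj : (m : ℕ) → Fin m → Fin m → Bool
cycAdj m a b =
  (suc (toℕ a) ≡ᵇ toℕ b) ∨ (suc (toℕ b) ≡ᵇ toℕ a)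
  ∨ ((toℕ a ≡ᵇ 0) ∧ (suc (toℕ b) ≡ᵇ m))
  ∨ ((toℕ b ≡ᵇ 0) ∧ (suc (toℕ a) ≡ᵇ m))

-- Paw on u1,u2,u3,u4 = 0,1,2,3: triangle 0,1,2 and 3 adjacent only to 0.
pawE : ℕ → ℕ → Bool
pawE 0 1 = true
pawE 1 0 = true
pawE 0 2 = true
pawE 2 0 = true
pawE 1 2 = true
pawE 2 1 = true
pawE 0 3 = true
pawE 3 0 = true
pawE _ _ = false

pawAdj : Fin 4 → Fin 4 → Bool
pawAdj a b = pawE (toℕ a) (toℕ b)

diamondE : ℕ → ℕ → Bool
diamondE 0 1 = true
diamondE 1 0 = true
diamondE 0 2 = true
diamondE 2 0 = true
diamondE 1 2 = true
diamondE 2 1 = true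
diamondE 0 3 = true
diamondE 3 0 = true
diamondE 1 3 = true
diamondE 3 1 = true
diamondE _ _ = false

diamondAdj : Fin 4 → Fin 4 → Bool
diamondAdj a b = diamondE (toℕ a) (toℕ b)

InducedIn : {n : ℕ} (k : ℕ) → (Fin k → Fin k → Bool) → Graph n → Set
InducedIn {n} k H G =
  Σ (Fin k → Fin n) λ f → Injective _≡_ _≡_ f × (∀ i j → adj G (f i) (f j) ≡ H i j)

CompIsClique : {n : ℕ} → Graph n → Fin n → Set
CompIsClique {n} G v = ∀ (a b : Fin n) → Reach G v a → Reach G v b → a ≢ b → adj G a b ≡ true

CycleInComp : {n : ℕ} → Graph n → Fin n → Set
CycleInComp {n} G v =
  Σ ℕ λ m → (3 ≤ m) × Σ (Fin m → Fin n) λ f →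
    Injective _≡_ _≡_ f × (∀ i j → cycAdj m i j ≡ true → adj G (f i) (f j) ≡ true)
    × (∀ i → Reach G v (f i))

-- The component of v is a tree (it is connected by definition; tree = acyclic).
CompIsTree : {n : ℕ} → Graph n → Fin n → Set
CompIsTree G v = ¬ CycleInComp G v

InClassG : {n : ℕ} → Graph n → Set
InClassG {n} G = ∀ (v : Fin n) → CompIsClique G v ⊎ CompIsTree G v

-- Without induced paws and diamonds, a triangle spreads: every edge at a vertex of a triangle
-- lies on a triangle, and the closed neighbourhood of a triangle vertex is closed under adjacency.
-- So a component is a clique as soon as one (equivalently, every) vertex of it lies on a triangle,
-- which is decidable. Otherwise the component is a tree: shortcutting a cycle along chords ends in
-- a chordless cycle, that is a triangle or an induced cycle of length at least four. Conversely,
-- a paw, a diamond or a long induced cycle puts a cycle and a non-adjacent pair into one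
-- component, which is then neither a tree nor a clique.
module Submission where

open import Defs
open import Data.Bool as Bool using (Bool; true; false; T)
open import Data.Bool.Properties using (T-≡; T-∨; T-∧; ⇔→≡)
open import Data.Empty using (⊥-elim)
open import Data.Fin as Fin using (Fin; zero; suc; toℕ; fromℕ<; _≟_)
open import Data.Fin.Properties using (any?; all?; toℕ-injective; toℕ<n; toℕ≤pred[n]; toℕ-fromℕ<; fromℕ<-toℕ)
import Data.Fin.Properties as Finₚ
open import Data.Nat as ℕ using (ℕ; zero; suc; _+_; _≤_; _<_; z≤n; s≤s; _≡ᵇ_)
open import Data.Nat.Induction using (<-rec)
open import Data.Nat.Properties
  using (≡ᵇ⇒≡; ≡⇒≡ᵇ; ≤-refl; ≤-trans; <⇒≤; <-≤-trans; ≤∧≢⇒<; n≮n; +-suc; +-comm;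
         +-identityʳ; +-cancelˡ-≡; +-monoʳ-≤; m≤n+m; m≤n⇒∃[o]m+o≡n; <-cmp)
open import Data.Product using (_×_; _,_; ∃; ∃₂; proj₁; proj₂)
open import Data.Product.Function.NonDependent.Propositional using (_×-⇔_)
open import Data.Sum using (_⊎_; inj₁; inj₂)
open import Data.Sum.Function.Propositional using (_⊎-⇔_)
open import Data.Vec.Functional using ([]; _∷_)
open import Function using (_∘_; case_of_)
open import Function.Bundles using (_⇔_; mk⇔; Equivalence)
open import Function.Construct.Composition using (_⇔-∘_)
import Function.Construct.Symmetry as Sym
open import Function.Definitions using (Injective)
open import Relation.Binary.Definitions using (tri<; tri≈; tri>)
open import Relation.Binary.PropositionalEquality using (_≡_; _≢_; refl; trans; cong; subst)
  renaming (sym to ≡-sym)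
open import Relation.Nullary using (¬_; Dec; yes; no)
open import Relation.Nullary.Decidable using (_×-dec_; ¬?; from-yes; decidable-stable)

pattern i0 = zero
pattern i1 = suc i0
pattern i2 = suc i1
pattern i3 = suc i2

Consecutive : ℕ → ℕ → ℕ → Set
Consecutive m a b = suc a ≡ b ⊎ suc b ≡ a ⊎ (a ≡ 0 × suc b ≡ m) ⊎ (b ≡ 0 × suc a ≡ m)

Consecutive-sym : ∀ {m a b} → Consecutive m a b → Consecutive m b a
Consecutive-sym (inj₁ e)               = inj₂ (inj₁ e)
Consecutive-sym (inj₂ (inj₁ e))        = inj₁ e
Consecutive-sym (inj₂ (inj₂ (inj₁ e))) = inj₂ (inj₂ (inj₂ e))
Consecutive-sym (inj₂ (inj₂ (inj₂ e))) = inj₂ (inj₂ (inj₁ e))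

T-≡ᵇ : ∀ {a b} → T (a ≡ᵇ b) ⇔ a ≡ b
T-≡ᵇ {a} {b} = mk⇔ (≡ᵇ⇒≡ a b) (≡⇒≡ᵇ a b)

T-∨-⇔ : ∀ {x y} {A B : Set} → T x ⇔ A → T y ⇔ B → T (x Bool.∨ y) ⇔ (A ⊎ B)
T-∨-⇔ x⇔A y⇔B = (x⇔A ⊎-⇔ y⇔B) ⇔-∘ T-∨

T-∧-⇔ : ∀ {x y} {A B : Set} → T x ⇔ A → T y ⇔ B → T (x Bool.∧ y) ⇔ (A × B)
T-∧-⇔ x⇔A y⇔B = (x⇔A ×-⇔ y⇔B) ⇔-∘ T-∧

cycAdj⇔Consecutive : ∀ m (i j : Fin m) → cycAdj m i j ≡ true ⇔ Consecutive m (toℕ i) (toℕ j)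
cycAdj⇔Consecutive m i j =
  T-∨-⇔ T-≡ᵇ (T-∨-⇔ T-≡ᵇ (T-∨-⇔ (T-∧-⇔ T-≡ᵇ T-≡ᵇ) (T-∧-⇔ T-≡ᵇ T-≡ᵇ))) ⇔-∘ Sym.⇔-sym T-≡

consecutive⇒cycAdj : ∀ {m} (i j : Fin m) → Consecutive m (toℕ i) (toℕ j) → cycAdj m i j ≡ true
consecutive⇒cycAdj i j = Equivalence.from (cycAdj⇔Consecutive _ i j)

cycAdj⇒consecutive : ∀ {m} (i j : Fin m) → cycAdj m i j ≡ true → Consecutive m (toℕ i) (toℕ j)
cycAdj⇒consecutive i j = Equivalence.to (cycAdj⇔Consecutive _ i j)

-- Out of range, clamp returns the junk value zero.
clamp : (ℓ : ℕ) → ℕ → Fin (suc ℓ)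
clamp ℓ a with a ℕ.<? suc ℓ
... | yes a<1+ℓ = fromℕ< a<1+ℓ
... | no _      = zero

toℕ-clamp : ∀ {ℓ a} → a ≤ ℓ → toℕ (clamp ℓ a) ≡ a
toℕ-clamp {ℓ} {a} a≤ℓ with a ℕ.<? suc ℓ
... | yes a<1+ℓ = toℕ-fromℕ< a<1+ℓ
... | no a≮1+ℓ  = ⊥-elim (a≮1+ℓ (s≤s a≤ℓ))

chord-gap : ∀ a d → a < a + d → suc a ≢ a + d → 2 ≤ d
chord-gap a zero          a<a+0 _  = ⊥-elim (n≮n a (subst (a <_) (+-identityʳ a) a<a+0))
chord-gap a (suc zero)    _     ne = ⊥-elim (ne (+-comm 1 a))
chord-gap a (suc (suc d)) _     _  = s≤s (s≤s z≤n)

chord-shorter : ∀ a d ℓ → a + d ≤ ℓ → ¬ (a ≡ 0 × suc (a + d) ≡ suc ℓ) → d < ℓ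
chord-shorter zero    d ℓ d≤ℓ ¬ends = ≤∧≢⇒< d≤ℓ (λ d≡ℓ → ¬ends (refl , cong suc d≡ℓ))
chord-shorter (suc a) d ℓ a+d<ℓ _   = <-≤-trans (s≤s (m≤n+m d a)) a+d<ℓ

SymmetricAdj IrreflexiveAdj : ∀ {k} → (Fin k → Fin k → Bool) → Set
SymmetricAdj H   = ∀ i j → H i j ≡ H j i
IrreflexiveAdj H = ∀ i → H i i ≡ false

symmetricAdj? : ∀ {k} (H : Fin k → Fin k → Bool) → Dec (SymmetricAdj H)
symmetricAdj? H = all? λ i → all? λ j → H i j Bool.≟ H j i

irreflexiveAdj? : ∀ {k} (H : Fin k → Fin k → Bool) → Dec (IrreflexiveAdj H)
irreflexiveAdj? H = all? λ i → H i i Bool.≟ false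

paw diamond : Graph 4
paw = record
  { adj = pawAdj ; sym = from-yes (symmetricAdj? pawAdj) ; irrefl = from-yes (irreflexiveAdj? pawAdj) }
diamond = record
  { adj = diamondAdj ; sym = from-yes (symmetricAdj? diamondAdj) ; irrefl = from-yes (irreflexiveAdj? diamondAdj) }

triangle : Graph 3
triangle = record
  { adj = cycAdj 3 ; sym = from-yes (symmetricAdj? (cycAdj 3)) ; irrefl = from-yes (irreflexiveAdj? (cycAdj 3)) }

module _ {n : ℕ} (G : Graph n) where

  private variable
    u v w x p q r : Fin n

  Edge : Fin n → Fin n → Set
  Edge u v = adj G u v ≡ true

  Edge? : ∀ u v → Dec (Edge u v)
  Edge? u v = adj G u v Bool.≟ true

  Edge-sym : Edge u v → Edge v u
  Edge-sym {u} {v} e = trans (Graph.sym G v u) e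

  Edge⇒≢ : Edge u v → u ≢ v
  Edge⇒≢ {u} e refl = case trans (≡-sym e) (irrefl G u) of λ ()

  Reach-snoc : Reach G u v → Edge v w → Reach G u w
  Reach-snoc here        e = step e here
  Reach-snoc (step e' r) e = step e' (Reach-snoc r e)

  Reach-trans : Reach G u v → Reach G v w → Reach G u w
  Reach-trans here       r' = r'
  Reach-trans (step e r) r' = step e (Reach-trans r r')

  Reach-sym : Reach G u v → Reach G v u
  Reach-sym here       = here
  Reach-sym (step e r) = Reach-snoc (Reach-sym r) (Edge-sym e)

  Triangle : Fin n → Fin n → Fin n → Set
  Triangle p q r = Edge p q × Edge q r × Edge p r

  OnTriangle : Fin n → Set
  OnTriangle p = ∃₂ λ q r → Triangle p q r

  onTriangle? : ∀ p → Dec (OnTriangle p)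
  onTriangle? p = any? λ q → any? λ r → Edge? p q ×-dec Edge? q r ×-dec Edge? p r

  UpperAgrees : ∀ {k} → (Fin k → Fin n) → (Fin k → Fin k → Bool) → Set
  UpperAgrees f H = ∀ i j → i Fin.< j → f i ≢ f j × adj G (f i) (f j) ≡ H i j

  induced-from-upper : ∀ {k} (H : Graph k) (f : Fin k → Fin n) → UpperAgrees f (adj H) → InducedIn k (adj H) G
  induced-from-upper H f upper = f , f-injective , f-adj
    where
    f-injective : Injective _≡_ _≡_ f
    f-injective {i} {j} fi≡fj with Finₚ.<-cmp i j
    ... | tri< i<j _ _ = ⊥-elim (proj₁ (upper i j i<j) fi≡fj)
    ... | tri≈ _ i≡j _ = i≡j
    ... | tri> _ _ j<i = ⊥-elim (proj₁ (upper j i j<i) (≡-sym fi≡fj))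

    f-adj : ∀ i j → adj G (f i) (f j) ≡ adj H i j
    f-adj i j with Finₚ.<-cmp i j
    ... | tri< i<j _ _  = proj₂ (upper i j i<j)
    ... | tri≈ _ refl _ = trans (irrefl G (f i)) (≡-sym (irrefl H i))
    ... | tri> _ _ j<i  = trans (Graph.sym G (f i) (f j)) (trans (proj₂ (upper j i j<i)) (Graph.sym H j i))

  triangle⇒induced : Triangle p q r → InducedIn 3 (cycAdj 3) G
  triangle⇒induced {p} {q} {r} (pq , qr , pr) = induced-from-upper triangle (p ∷ q ∷ r ∷ []) upper
    where
    upper : UpperAgrees (p ∷ q ∷ r ∷ []) (cycAdj 3)
    upper i0 i1 _ = Edge⇒≢ pq , pq
    upper i0 i2 _ = Edge⇒≢ pr , pr
    upper i1 i2 _ = Edge⇒≢ qr , qr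
    upper i0 i0 ()
    upper (suc _) i0 ()
    upper (suc _) i1 (s≤s ())
    upper (suc (suc _)) i2 (s≤s (s≤s ()))

  pawOrDiamond : Triangle p q r → Edge p x → q ≢ x → r ≢ x → adj G r x ≡ false →
                 InducedIn 4 pawAdj G ⊎ InducedIn 4 diamondAdj G
  pawOrDiamond {p} {q} {r} {x} (pq , qr , pr) px q≢x r≢x rx with adj G q x in qx
  ... | false = inj₁ (induced-from-upper paw (p ∷ q ∷ r ∷ x ∷ []) upper)
    where
    upper : UpperAgrees (p ∷ q ∷ r ∷ x ∷ []) pawAdj
    upper i0 i1 _ = Edge⇒≢ pq , pq
    upper i0 i2 _ = Edge⇒≢ pr , pr
    upper i0 i3 _ = Edge⇒≢ px , px
    upper i1 i2 _ = Edge⇒≢ qr , qr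
    upper i1 i3 _ = q≢x , qx
    upper i2 i3 _ = r≢x , rx
    upper i0 i0 ()
    upper (suc _) i0 ()
    upper (suc _) i1 (s≤s ())
    upper (suc (suc _)) i2 (s≤s (s≤s ()))
    upper i3 i3 (s≤s (s≤s (s≤s ())))
  ... | true = inj₂ (induced-from-upper diamond (p ∷ q ∷ r ∷ x ∷ []) upper)
    where
    upper : UpperAgrees (p ∷ q ∷ r ∷ x ∷ []) diamondAdj
    upper i0 i1 _ = Edge⇒≢ pq , pq
    upper i0 i2 _ = Edge⇒≢ pr , pr
    upper i0 i3 _ = Edge⇒≢ px , px
    upper i1 i2 _ = Edge⇒≢ qr , qr
    upper i1 i3 _ = q≢x , qx
    upper i2 i3 _ = r≢x , rx
    upper i0 i0 ()
    upper (suc _) i0 ()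
    upper (suc _) i1 (s≤s ())
    upper (suc (suc _)) i2 (s≤s (s≤s ()))
    upper i3 i3 (s≤s (s≤s (s≤s ())))

  cycle-reach : ∀ {m} (f : Fin (suc m) → Fin n) → (∀ i j → cycAdj (suc m) i j ≡ true → Edge (f i) (f j)) →
                ∀ i → Reach G (f zero) (f i)
  cycle-reach {m} f edge i = subst (Reach G (f zero) ∘ f) (fromℕ<-toℕ i (toℕ<n i)) (reach (toℕ i) (toℕ<n i))
    where
    reach : ∀ t (t<1+m : t < suc m) → Reach G (f zero) (f (fromℕ< t<1+m))
    reach zero    _       = here
    reach (suc t) t+1<1+m = Reach-snoc (reach t t<1+m) (edge _ _ (consecutive⇒cycAdj _ _ (inj₁ next)))
      where
      t<1+m : t < suc m
      t<1+m = <⇒≤ t+1<1+m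
      next : suc (toℕ (fromℕ< t<1+m)) ≡ toℕ (fromℕ< t+1<1+m)
      next = trans (cong suc (toℕ-fromℕ< t<1+m)) (≡-sym (toℕ-fromℕ< t+1<1+m))

  inducedCycle⇒cycleInComp : ∀ {m} → 2 ≤ m → (cycle : InducedIn (suc m) (cycAdj (suc m)) G) →
                             CycleInComp G (proj₁ cycle zero)
  inducedCycle⇒cycleInComp {m} 2≤m (f , f-injective , f-adj) =
    suc m , s≤s 2≤m , f , f-injective , edge , cycle-reach f edge
    where
    edge : ∀ i j → cycAdj (suc m) i j ≡ true → Edge (f i) (f j)
    edge i j = trans (f-adj i j)

  cycle∧nonEdge⇒¬InClassG : ∀ {a b} → CycleInComp G v → Reach G v a → Reach G v b → a ≢ b →
                            adj G a b ≡ false → ¬ InClassG G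
  cycle∧nonEdge⇒¬InClassG {v} {a} {b} cycle va vb a≢b ab inClass with inClass v
  ... | inj₁ clique = case trans (≡-sym (clique a b va vb a≢b)) ab of λ ()
  ... | inj₂ tree   = tree cycle

  trianglePendant⇒¬InClassG : ∀ {H : Fin 4 → Fin 4 → Bool} →
    H i0 i1 ≡ true → H i1 i2 ≡ true → H i0 i2 ≡ true → H i0 i3 ≡ true → H i2 i3 ≡ false →
    InducedIn 4 H G → ¬ InClassG G
  trianglePendant⇒¬InClassG h01 h12 h02 h03 h23 (f , f-injective , f-adj) =
    cycle∧nonEdge⇒¬InClassG (inducedCycle⇒cycleInComp ≤-refl (triangle⇒induced f012))
      (step (trans (f-adj i0 i2) h02) here) (step (trans (f-adj i0 i3) h03) here)
      (λ f2≡f3 → case f-injective f2≡f3 of λ ()) (trans (f-adj i2 i3) h23)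
    where
    f012 : Triangle (f i0) (f i1) (f i2)
    f012 = trans (f-adj i0 i1) h01 , trans (f-adj i1 i2) h12 , trans (f-adj i0 i2) h02

  longInducedCycle⇒¬InClassG : ∀ k → InducedIn (4 + k) (cycAdj (4 + k)) G → ¬ InClassG G
  longInducedCycle⇒¬InClassG k cycle@(f , f-injective , f-adj) =
    cycle∧nonEdge⇒¬InClassG (inducedCycle⇒cycleInComp (s≤s (s≤s z≤n)) cycle)
      here (step (f-adj i0 i1) (step (f-adj i1 i2) here))
      (λ f0≡f2 → case f-injective f0≡f2 of λ ()) (f-adj i0 i2)

  ClosedNbhd : Fin n → Fin n → Set
  ClosedNbhd u v = v ≡ u ⊎ Edge u v

  module _ (noPaw : ¬ InducedIn 4 pawAdj G) (noDiamond : ¬ InducedIn 4 diamondAdj G) where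

    triangle-neighbour : Triangle p q r → Edge p x → x ≢ q → Edge q x
    triangle-neighbour {q = q} {r} {x} (pq , qr , pr) px x≢q with x ≟ r
    ... | yes refl = qr
    ... | no x≢r with adj G q x in qx
    ...   | true  = refl
    ...   | false with pawOrDiamond (pr , Edge-sym qr , pq) px (x≢r ∘ ≡-sym) (x≢q ∘ ≡-sym) qx
    ...     | inj₁ isPaw     = ⊥-elim (noPaw isPaw)
    ...     | inj₂ isDiamond = ⊥-elim (noDiamond isDiamond)

    edge-on-triangle : Triangle p q r → Edge p x → ∃ λ s → Triangle x p s
    edge-on-triangle {q = q} {r} {x} t@(pq , qr , pr) px with x ≟ q
    ... | yes refl = r , Edge-sym pq , pr , qr
    ... | no x≢q   = q , Edge-sym px , pq , Edge-sym (triangle-neighbour t px x≢q)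

    reach-onTriangle : OnTriangle u → Reach G u v → OnTriangle v
    reach-onTriangle t             here         = t
    reach-onTriangle (_ , _ , uqr) (step ux xv) with edge-on-triangle uqr ux
    ... | s , xus = reach-onTriangle (_ , s , xus) xv

    closedNbhd-step : OnTriangle u → ClosedNbhd u v → Edge v w → ClosedNbhd u w
    closedNbhd-step _ (inj₁ refl) vw = inj₂ vw
    closedNbhd-step {u} {w = w} (_ , _ , uqr) (inj₂ uv) vw with w ≟ u
    ... | yes w≡u = inj₁ w≡u
    ... | no w≢u  = inj₂ (triangle-neighbour (proj₂ (edge-on-triangle uqr uv)) vw w≢u)

    reach-closedNbhd : OnTriangle u → ClosedNbhd u v → Reach G v w → ClosedNbhd u w
    reach-closedNbhd t uv here         = uv
    reach-closedNbhd t uv (step vx xw) = reach-closedNbhd t (closedNbhd-step t uv vx) xw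

    onTriangle⇒clique : OnTriangle v → CompIsClique G v
    onTriangle⇒clique t a b va vb a≢b
      with reach-closedNbhd (reach-onTriangle t va) (inj₁ refl) (Reach-trans (Reach-sym va) vb)
    ... | inj₁ b≡a = ⊥-elim (a≢b (≡-sym b≡a))
    ... | inj₂ ab  = ab

  -- The cycle vertex 0, vertex 1, …, vertex ℓ (of length ℓ + 1); vertex is junk beyond ℓ.
  record Cycle (P : Fin n → Set) (ℓ : ℕ) : Set where
    field
      vertex     : ℕ → Fin n
      nontrivial : 2 ≤ ℓ
      injective  : ∀ a b → a ≤ ℓ → b ≤ ℓ → vertex a ≡ vertex b → a ≡ b
      edge       : ∀ a → a < ℓ → Edge (vertex a) (vertex (suc a))
      closing    : Edge (vertex 0) (vertex ℓ)
      inP        : ∀ a → a ≤ ℓ → P (vertex a)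

  cycleInComp⇒cycle : CycleInComp G v → ∃ (Cycle (Reach G v))
  cycleInComp⇒cycle (suc ℓ , s≤s 2≤ℓ , f , f-injective , f-edge , f-reach) = ℓ , record
    { vertex     = vertex
    ; nontrivial = 2≤ℓ
    ; injective  = λ a b a≤ℓ b≤ℓ fa≡fb →
        trans (≡-sym (toℕ-clamp a≤ℓ)) (trans (cong toℕ (f-injective fa≡fb)) (toℕ-clamp b≤ℓ))
    ; edge       = λ a a<ℓ → f-edge _ _ (consecutive⇒cycAdj (clamp ℓ a) (clamp ℓ (suc a))
        (inj₁ (trans (cong suc (toℕ-clamp (<⇒≤ a<ℓ))) (≡-sym (toℕ-clamp a<ℓ)))))
    ; closing    = f-edge _ _ (consecutive⇒cycAdj (clamp ℓ 0) (clamp ℓ ℓ)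
        (inj₂ (inj₂ (inj₁ (toℕ-clamp {ℓ} z≤n , cong suc (toℕ-clamp ≤-refl))))))
    ; inP        = λ a _ → f-reach (clamp ℓ a)
    }
    where
    vertex : ℕ → Fin n
    vertex a = f (clamp ℓ a)

  module _ {P : Fin n → Set} {ℓ : ℕ} (C : Cycle P ℓ) where
    open Cycle C

    Chordless : Set
    Chordless = ∀ (i j : Fin (suc ℓ)) → Edge (vertex (toℕ i)) (vertex (toℕ j)) → cycAdj (suc ℓ) i j ≡ true

    consecutive⇒edge : ∀ {a b} → a ≤ ℓ → b ≤ ℓ → Consecutive (suc ℓ) a b → Edge (vertex a) (vertex b)
    consecutive⇒edge {a}     _   b≤ℓ (inj₁ refl)                      = edge a b≤ℓ
    consecutive⇒edge {b = b} a≤ℓ _   (inj₂ (inj₁ refl))               = Edge-sym (edge b a≤ℓ)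
    consecutive⇒edge         _   _   (inj₂ (inj₂ (inj₁ (refl , refl)))) = closing
    consecutive⇒edge         _   _   (inj₂ (inj₂ (inj₂ (refl , refl)))) = Edge-sym closing

    chordless⇒induced : Chordless → InducedIn (suc ℓ) (cycAdj (suc ℓ)) G
    chordless⇒induced chordless = vertex ∘ toℕ , injective′ , adj≡cycAdj
      where
      injective′ : Injective _≡_ _≡_ (vertex ∘ toℕ)
      injective′ {i} {j} = toℕ-injective ∘ injective _ _ (toℕ≤pred[n] i) (toℕ≤pred[n] j)
      adj≡cycAdj : ∀ i j → adj G (vertex (toℕ i)) (vertex (toℕ j)) ≡ cycAdj (suc ℓ) i j
      adj≡cycAdj i j = ⇔→≡ (mk⇔ (chordless i j)
        (consecutive⇒edge (toℕ≤pred[n] i) (toℕ≤pred[n] j) ∘ cycAdj⇒consecutive i j))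

    chord-cycle : ∀ a d → a + d ≤ ℓ → 2 ≤ d → Edge (vertex a) (vertex (a + d)) → Cycle P d
    chord-cycle a d a+d≤ℓ 2≤d chord = record
      { vertex     = λ t → vertex (a + t)
      ; nontrivial = 2≤d
      ; injective  = λ s t s≤d t≤d eq → +-cancelˡ-≡ a s t (injective _ _ (within s≤d) (within t≤d) eq)
      ; edge       = λ t t<d → subst (Edge (vertex (a + t)) ∘ vertex) (≡-sym (+-suc a t))
                                     (edge (a + t) (subst (_≤ ℓ) (+-suc a t) (within t<d)))
      ; closing    = subst (λ a′ → Edge (vertex a′) (vertex (a + d))) (≡-sym (+-identityʳ a)) chord
      ; inP        = λ t t≤d → inP (a + t) (within t≤d)
      }
      where
      within : ∀ {t} → t ≤ d → a + t ≤ ℓ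
      within t≤d = ≤-trans (+-monoʳ-≤ a t≤d) a+d≤ℓ

    shortcut : ∀ {a b} → a < b → b ≤ ℓ → Edge (vertex a) (vertex b) → ¬ Consecutive (suc ℓ) a b →
               ∃ λ ℓ′ → ℓ′ < ℓ × Cycle P ℓ′
    shortcut {a} a<b b≤ℓ chord ¬consecutive with m≤n⇒∃[o]m+o≡n (<⇒≤ a<b)
    ... | d , refl = d , chord-shorter a d ℓ b≤ℓ (¬consecutive ∘ inj₂ ∘ inj₂ ∘ inj₁)
                       , chord-cycle a d b≤ℓ (chord-gap a d a<b (¬consecutive ∘ inj₁)) chord

    chordless-or-shorter : Chordless ⊎ ∃ λ ℓ′ → ℓ′ < ℓ × Cycle P ℓ′
    chordless-or-shorter
      with any? (λ i → any? λ j → Edge? (vertex (toℕ i)) (vertex (toℕ j)) ×-dec ¬? (cycAdj (suc ℓ) i j Bool.≟ true))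
    ... | no ¬chord = inj₁ λ i j e →
            decidable-stable (cycAdj (suc ℓ) i j Bool.≟ true) (λ ¬adj → ¬chord (i , j , e , ¬adj))
    ... | yes (i , j , e , ¬adj) with <-cmp (toℕ i) (toℕ j)
    ...   | tri< i<j _ _ = inj₂ (shortcut i<j (toℕ≤pred[n] j) e (¬adj ∘ consecutive⇒cycAdj i j))
    ...   | tri≈ _ i≡j _ = ⊥-elim (Edge⇒≢ e (cong vertex i≡j))
    ...   | tri> _ _ j<i = inj₂ (shortcut j<i (toℕ≤pred[n] i) (Edge-sym e)
                                   (¬adj ∘ consecutive⇒cycAdj i j ∘ Consecutive-sym))

  ChordlessCycleIn : (Fin n → Set) → Set
  ChordlessCycleIn P = ∃ λ ℓ → ∃ λ (C : Cycle P ℓ) → Chordless C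

  cycle⇒chordless : ∀ {P ℓ} → Cycle P ℓ → ChordlessCycleIn P
  cycle⇒chordless {P} {ℓ} = <-rec (λ ℓ → Cycle P ℓ → ChordlessCycleIn P) shorten ℓ
    where
    shorten : ∀ ℓ → (∀ {ℓ′} → ℓ′ < ℓ → Cycle P ℓ′ → ChordlessCycleIn P) → Cycle P ℓ → ChordlessCycleIn P
    shorten ℓ rec C with chordless-or-shorter C
    ... | inj₁ chordless             = ℓ , C , chordless
    ... | inj₂ (ℓ′ , ℓ′<ℓ , shorter) = rec ℓ′<ℓ shorter

  cycle⇒triangle⊎longInducedCycle : ∀ {P ℓ} → Cycle P ℓ →
    (∃ λ p → P p × OnTriangle p) ⊎ (∃ λ m → 4 ≤ m × InducedIn m (cycAdj m) G)
  cycle⇒triangle⊎longInducedCycle C with cycle⇒chordless C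
  ... | suc (suc zero) , C′ , _ =
    inj₁ (vertex 0 , inP 0 z≤n , vertex 1 , vertex 2 , edge 0 (s≤s z≤n) , edge 1 ≤-refl , closing)
    where open Cycle C′
  ... | suc (suc (suc ℓ)) , C′ , chordless =
    inj₂ (_ , s≤s (s≤s (s≤s (s≤s z≤n))) , chordless⇒induced C′ chordless)
  ... | zero     , C′ , _ = case Cycle.nontrivial C′ of λ ()
  ... | suc zero , C′ , _ = case Cycle.nontrivial C′ of λ { (s≤s ()) }

lemma8 : ∀ {n : ℕ} (G : Graph n) →
    InClassG G ⇔
      (¬ InducedIn 4 pawAdj G × ¬ InducedIn 4 diamondAdj G
        × (∀ (i : ℕ) → 4 ≤ i → ¬ InducedIn i (cycAdj i) G))
lemma8 G = mk⇔ forbidden-free in-class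
  where
  forbidden-free : InClassG G → ¬ InducedIn 4 pawAdj G × ¬ InducedIn 4 diamondAdj G
                     × (∀ (i : ℕ) → 4 ≤ i → ¬ InducedIn i (cycAdj i) G)
  forbidden-free inClass =
      (λ isPaw → trianglePendant⇒¬InClassG G refl refl refl refl refl isPaw inClass)
    , (λ isDiamond → trianglePendant⇒¬InClassG G refl refl refl refl refl isDiamond inClass)
    , λ { _ (s≤s (s≤s (s≤s (s≤s {n = k} _)))) isCycle → longInducedCycle⇒¬InClassG G k isCycle inClass }

  in-class : ¬ InducedIn 4 pawAdj G × ¬ InducedIn 4 diamondAdj G
               × (∀ (i : ℕ) → 4 ≤ i → ¬ InducedIn i (cycAdj i) G) → InClassG G
  in-class (noPaw , noDiamond , noLongCycle) v with onTriangle? G v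
  ... | yes onTriangle = inj₁ (onTriangle⇒clique G noPaw noDiamond onTriangle)
  ... | no ¬onTriangle = inj₂ λ cycle →
    case cycle⇒triangle⊎longInducedCycle G (proj₂ (cycleInComp⇒cycle G cycle)) of λ
      { (inj₁ (p , vp , onTriangle)) →
          ¬onTriangle (reach-onTriangle G noPaw noDiamond onTriangle (Reach-sym G vp))
      ; (inj₂ (m , 4≤m , isCycle))   → noLongCycle m 4≤m isCycle
      }
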